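{- Let $G$ be a Left dead end with a good option $H$ such that $\ell(G)=\ell(H)+1$. Then: (1) $H$ is a racing option of $G$; (2) there exists a unique (up to equality) atom $K$ such that $G=H+K$, and $K$ is terminable; (3) every longest factorisation of $G$ is of the form $H_1+\dots+H_k+K$, where $H_1+\dots+H_k$ is a longest factorisation of $H$; and (4) if $H$ admits a unique longest factorisation, then so does $G$.
   Context: All games are short partizan combinatorial game forms; $G+H$ is the disjunctive sum; $\cong$ denotes identity of forms. Play is misère (a player unable to move wins). Misère outcome classes are ordered $\mathscr L>\mathscr P>\mathscr R$ and $\mathscr L>\mathscr N>\mathscr R$; $G\geq H$ means that for every game $X$ the misère outcome of $G+X$ is $\geq$ that of $H+X$, $G=H$ means $G\ge H$ and $H\ge G$, and $G>H$ means $G\ge H$ and $G\ne H$. A Left dead end is a game no subposition of which (including itself) has a Left option; its options are its Right options. An option $G'$ of $G$ is good if there is no option $G''$ of $G$ with $G'>G''$. A run of length $k$ of $G$ is a sequence $(G_0,\dots,G_k)$ with $G_0\cong G$ and $G_{i+1}$ an option of $G_i$; it is terminal if $G_k\cong0=\{\cdot\mid\cdot\}$; $\operatorname{race}(G)$ is the minimum length of a terminal run of $G$. A racing option of $G$ is an option $G'$ with $\operatorname{race}(G')=\operatorname{race}(G)-1$. A Left dead end is terminable if it has $0$ as an option (equivalently has race $1$). An atom is a Left dead end $A\neq0$ such that $A=X+Y$ with Left dead ends $X,Y$ implies $X=0$ or $Y=0$. A factorisation of $G$ is an expression $G=A_1+\dots+A_k$ with atoms $A_i$, considered up to reordering and replacing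 atoms by equal ones; its length is $k$; $\ell(G)$ is the length of a longest factorisation of $G$. -}

module Defs where

open import Data.Nat using (ℕ; zero; suc; _≤_)
open import Data.List using (List; []; _∷_; _++_; length)
open import Data.List.Membership.Propositional using (_∈_)
open import Data.Product using (Σ; Σ-syntax; _×_; _,_; proj₁; proj₂)
open import Data.Sum using (_⊎_)
open import Data.Empty using (⊥)
open import Data.Unit using (⊤)
open import Function using (id; _∘_)
open import Relation.Nullary using (¬_)
open import Relation.Binary.PropositionalEquality using (_≡_)
open import Relation.Binary.Bundles using (Setoid)
open import Relation.Binary.Structures using (IsEquivalence)

-- Short partizan game forms: a form is given by its list of Left options
-- and its list of Right options.  Identity of forms (≅) is _≡_.

data Game : Set where
  game : List Game → List Game → Game

leftOpts : Game → List Game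
leftOpts (game L R) = L

rightOpts : Game → List Game
rightOpts (game L R) = R

options : Game → List Game
options (game L R) = L ++ R

𝟘 : Game
𝟘 = game [] []

infixl 6 _+_

mutual
  _+_ : Game → Game → Game
  G@(game GL GR) + H@(game HL HR) =
    game (sumL GL H ++ sumR G HL) (sumL GR H ++ sumR G HR)

  sumL : List Game → Game → List Game
  sumL [] H = []
  sumL (g ∷ gs) H = (g + H) ∷ sumL gs H

  sumR : Game → List Game → List Game
  sumR G [] = []
  sumR G (h ∷ hs) = (G + h) ∷ sumR G hs

-- Misère play: a player unable to move wins.
-- LF G : Left wins G moving first;  RF G : Right wins G moving first.

mutual
  LF : Game → Set
  LF (game GL GR) = GL ≡ [] ⊎ LFany GL

  LFany : List Game → Set
  LFany [] = ⊥
  LFany (g ∷ gs) = ¬ RF g ⊎ LFany gs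

  RF : Game → Set
  RF (game GL GR) = GR ≡ [] ⊎ RFany GR

  RFany : List Game → Set
  RFany [] = ⊥
  RFany (g ∷ gs) = ¬ LF g ⊎ RFany gs

-- The misère outcome of G is encoded by the pair
--   (Left wins moving first , Left wins moving second) = (LF G , ¬ RF G),
-- so L = (yes,yes), N = (yes,no), P = (no,yes), R = (no,no); the order
-- L > P > R, L > N > R is exactly the componentwise order.
OutcomeGeq : Game → Game → Set
OutcomeGeq G H = (LF H → LF G) × (RF G → RF H)

infix 4 _≥_ _≈_ _>_

_≥_ : Game → Game → Set
G ≥ H = (X : Game) → OutcomeGeq (G + X) (H + X)

_≈_ : Game → Game → Set
G ≈ H = G ≥ H × H ≥ G

_>_ : Game → Game → Set
G > H = G ≥ H × ¬ (G ≈ H)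

≥-refl : (G : Game) → G ≥ G
≥-refl G X = id , id

≥-trans : (G H K : Game) → G ≥ H → H ≥ K → G ≥ K
≥-trans G H K p q X =
  (proj₁ (p X) ∘ proj₁ (q X)) , (proj₂ (q X) ∘ proj₂ (p X))

≈-isEquivalence : IsEquivalence _≈_
≈-isEquivalence = record
  { refl  = λ {G} → ≥-refl G , ≥-refl G
  ; sym   = λ p → proj₂ p , proj₁ p
  ; trans = λ {G} {H} {K} p q →
      ≥-trans G H K (proj₁ p) (proj₁ q) , ≥-trans K H G (proj₂ q) (proj₂ p)
  }

GameSetoid : Setoid _ _
GameSetoid = record { Carrier = Game ; _≈_ = _≈_ ; isEquivalence = ≈-isEquivalence }

mutual
  LeftDeadEnd : Game → Set
  LeftDeadEnd (game [] GR) = AllLeftDeadEnd GR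
  LeftDeadEnd (game (_ ∷ _) GR) = ⊥

  AllLeftDeadEnd : List Game → Set
  AllLeftDeadEnd [] = ⊤
  AllLeftDeadEnd (g ∷ gs) = LeftDeadEnd g × AllLeftDeadEnd gs

Terminable : Game → Set
Terminable A = LeftDeadEnd A × 𝟘 ∈ options A

IsGoodOption : Game → Game → Set
IsGoodOption G H =
  H ∈ options G × ((H'' : Game) → H'' ∈ options G → ¬ (H > H''))

TerminalRun : Game → ℕ → Set
TerminalRun G zero = G ≡ 𝟘
TerminalRun G (suc k) = Σ[ G' ∈ Game ] (G' ∈ options G × TerminalRun G' k)

IsRace : Game → ℕ → Set
IsRace G r = TerminalRun G r × ((k : ℕ) → TerminalRun G k → r ≤ k)

IsRacingOption : Game → Game → Set
IsRacingOption G H =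
  H ∈ options G × Σ[ r ∈ ℕ ] (IsRace H r × IsRace G (suc r))

IsAtom : Game → Set
IsAtom A =
  LeftDeadEnd A × ¬ (A ≈ 𝟘) ×
  ((X Y : Game) → LeftDeadEnd X → LeftDeadEnd Y → A ≈ X + Y →
     X ≈ 𝟘 ⊎ Y ≈ 𝟘)

sumList : List Game → Game
sumList [] = 𝟘
sumList (A ∷ As) = A + sumList As

data AllAtoms : List Game → Set where
  []  : AllAtoms []
  _∷_ : {A : Game} {As : List Game} → IsAtom A → AllAtoms As → AllAtoms (A ∷ As)

IsFactorisation : Game → List Game → Set
IsFactorisation G As = AllAtoms As × G ≈ sumList As

-- Factorisations are considered up to reordering and replacing atoms by
-- equal ones: permutation up to the setoid equality _≈_.
open import Data.List.Relation.Binary.Permutation.Setoid GameSetoid public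
  using () renaming (_↭_ to _≈Fac_)

HasMaxFactorisationLength : Game → ℕ → Set
HasMaxFactorisationLength G n =
  Σ[ As ∈ List Game ] (IsFactorisation G As × length As ≡ n) ×
  ((Bs : List Game) → IsFactorisation G Bs → length Bs ≤ n)

IsLongestFactorisation : Game → List Game → Set
IsLongestFactorisation G As =
  IsFactorisation G As ×
  ((Bs : List Game) → IsFactorisation G Bs → length Bs ≤ length As)

HasUniqueLongestFactorisation : Game → Set
HasUniqueLongestFactorisation G =
  Σ[ As ∈ List Game ] IsLongestFactorisation G As ×
  ((Bs Cs : List Game) → IsLongestFactorisation G Bs →
     IsLongestFactorisation G Cs → Bs ≈Fac Cs)

{-# OPTIONS --safe #-}

-- For Left dead ends, G ≥ H holds exactly when every Right option of G lies above some Right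
-- option of H (and G = 0 forces H = 0). This structural order makes ≥ decidable on dead ends, and
-- it shows that addition of dead ends is cancellative and that race is additive.
--
-- Write G = A₁ + … + Aₙ₊₁ as a longest factorisation. The good option H is equal to some Right
-- option of this sum, since anything matched strictly below H would contradict goodness; so H is
-- A₁ + … + A′ᵢ + … + Aₙ₊₁ for a Right option A′ᵢ of one atom. If A′ᵢ ≠ 0, any factorisation of
-- A′ᵢ has at least one atom, and together with the other n atoms it factorises H into more than
-- ℓ(H) atoms. Hence A′ᵢ = 0: K = Aᵢ is terminable and G = H + K. Cancellation makes K unique and
-- identifies the extra atom of every longest factorisation of G with K, and additivity of race
-- gives race(G) = race(H) + 1.

module Submission where

open import Defs
open import Data.Nat using (ℕ; zero; suc; _≤_; _<_; z≤n; s≤s) renaming (_+_ to _+ℕ_)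
import Data.Nat.Properties as ℕ
open import Data.Nat.Induction using (<-wellFounded)
open import Data.List using (List; []; _∷_; _++_; length; [_])
open import Data.List.Properties using (++-identityʳ; length-++; length-++-sucʳ)
open import Data.List.Membership.Propositional using (_∈_; mapWith∈; find; lose)
open import Data.List.Membership.Propositional.Properties using (∈-++⁻; ∈-++⁺ˡ; ∈-++⁺ʳ)
open import Data.List.Relation.Binary.Subset.Propositional using (_⊆_)
open import Data.List.Relation.Unary.All using (All; []; _∷_; lookup; tabulate; uncons)
open import Data.List.Relation.Unary.All.Properties using (¬All⇒Any¬)
open import Data.List.Relation.Unary.Any using (here; there; any?)
open import Data.List.Relation.Unary.Any.Properties using (mapWith∈⁺; mapWith∈⁻)
open import Data.List.Relation.Binary.Permutation.Setoid GameSetoid using (↭-trans; ↭-sym)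
open import Data.List.Relation.Binary.Permutation.Setoid.Properties GameSetoid
  using (shift; ++⁺ʳ; ++-comm)
open import Data.Product using (Σ; Σ-syntax; ∃-syntax; ∃₂; _×_; _,_; proj₁; proj₂; uncurry)
open import Data.Sum using (_⊎_; inj₁; inj₂; [_,_]′)
open import Data.Empty using (⊥; ⊥-elim)
open import Data.Unit using (tt)
open import Function using (_∘_; id; case_of_)
open import Induction.WellFounded using (WellFounded; Acc; acc)
open import Relation.Nullary using (¬_; Dec; yes; no; contradiction)
open import Relation.Nullary.Decidable using (map′; _×-dec_; _→-dec_)
open import Relation.Unary using (Decidable)
open import Relation.Binary using (Setoid; IsEquivalence)
open import Relation.Binary.PropositionalEquality using (_≡_; _≢_; refl; sym; trans; cong; cong₂; subst)
open import Algebra.Bundles using (CommutativeMonoid)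
open import Algebra.Structures using (IsCommutativeMonoid)
import Relation.Binary.Reasoning.Setoid as SetoidReasoning

open Setoid GameSetoid using () renaming (refl to ≈-refl; sym to ≈-sym; trans to ≈-trans)

private variable
  A B C G H Y : Game
  As Bs as bs : List Game
  n : ℕ

-- Options and sums

infix 4 _◃_

_◃_ : Game → Game → Set
x ◃ G = x ∈ options G

mutual
  ◃-wellFounded : WellFounded _◃_
  ◃-wellFounded (game L R) = acc λ p → [ ∈-accessible L , ∈-accessible R ]′ (∈-++⁻ L p)

  ∈-accessible : ∀ xs {x} → x ∈ xs → Acc _◃_ x
  ∈-accessible (y ∷ ys) (here refl) = ◃-wellFounded y
  ∈-accessible (y ∷ ys) (there p)   = ∈-accessible ys p

leftOpt⇒option : ∀ G {x} → x ∈ leftOpts G → x ∈ options G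
leftOpt⇒option (game L R) = ∈-++⁺ˡ

rightOpt⇒option : ∀ G {x} → x ∈ rightOpts G → x ∈ options G
rightOpt⇒option (game L R) = ∈-++⁺ʳ L

≡𝟘? : (G : Game) → Dec (G ≡ 𝟘)
≡𝟘? (game [] [])      = yes refl
≡𝟘? (game [] (_ ∷ _)) = no λ ()
≡𝟘? (game (_ ∷ _) _)  = no λ ()

data SummandMove (A B : Game) (as bs : List Game) : Game → Set where
  moveˡ : ∀ {a} → a ∈ as → SummandMove A B as bs (a + B)
  moveʳ : ∀ {b} → b ∈ bs → SummandMove A B as bs (A + b)

summandMove-map : ∀ {as′ bs′ x} → as ⊆ as′ → bs ⊆ bs′ →
  SummandMove A B as bs x → SummandMove A B as′ bs′ x
summandMove-map f g (moveˡ p) = moveˡ (f p)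
summandMove-map f g (moveʳ p) = moveʳ (g p)

∈-sum⁻ : ∀ as bs {x} → x ∈ sumL as B ++ sumR A bs → SummandMove A B as bs x
∈-sum⁻ (a ∷ as) bs (here refl) = moveˡ (here refl)
∈-sum⁻ (a ∷ as) bs (there p)   = summandMove-map there id (∈-sum⁻ as bs p)
∈-sum⁻ [] (b ∷ bs) (here refl) = moveʳ (here refl)
∈-sum⁻ [] (b ∷ bs) (there p)   = summandMove-map id there (∈-sum⁻ [] bs p)

∈-sum⁺ˡ : ∀ as bs {a} → a ∈ as → a + B ∈ sumL as B ++ sumR A bs
∈-sum⁺ˡ (a ∷ as) bs (here refl) = here refl
∈-sum⁺ˡ (a ∷ as) bs (there p)   = there (∈-sum⁺ˡ as bs p)

∈-sum⁺ʳ : ∀ {A B} as bs {b} → b ∈ bs → A + b ∈ sumL as B ++ sumR A bs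
∈-sum⁺ʳ (a ∷ as) bs p           = there (∈-sum⁺ʳ as bs p)
∈-sum⁺ʳ [] (b ∷ bs) (here refl) = here refl
∈-sum⁺ʳ {A} {B} [] (b ∷ bs) (there p) = there (∈-sum⁺ʳ {A} {B} [] bs p)

leftOpts-+⁻ : ∀ A B {x} → x ∈ leftOpts (A + B) → SummandMove A B (leftOpts A) (leftOpts B) x
leftOpts-+⁻ (game AL _) (game BL _) = ∈-sum⁻ AL BL

rightOpts-+⁻ : ∀ A B {x} → x ∈ rightOpts (A + B) → SummandMove A B (rightOpts A) (rightOpts B) x
rightOpts-+⁻ (game _ AR) (game _ BR) = ∈-sum⁻ AR BR

options-+⁻ : ∀ A B {x} → x ∈ options (A + B) → SummandMove A B (options A) (options B) x
options-+⁻ A@(game _ _) B@(game _ _) p with ∈-++⁻ (leftOpts (A + B)) p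
... | inj₁ q = summandMove-map (leftOpt⇒option A) (leftOpt⇒option B) (leftOpts-+⁻ A B q)
... | inj₂ q = summandMove-map (rightOpt⇒option A) (rightOpt⇒option B) (rightOpts-+⁻ A B q)

leftOpts-+⁺ˡ : ∀ A B {a} → a ∈ leftOpts A → a + B ∈ leftOpts (A + B)
leftOpts-+⁺ˡ (game AL _) (game BL _) = ∈-sum⁺ˡ AL BL

leftOpts-+⁺ʳ : ∀ A B {b} → b ∈ leftOpts B → A + b ∈ leftOpts (A + B)
leftOpts-+⁺ʳ (game AL _) (game BL _) = ∈-sum⁺ʳ AL BL

rightOpts-+⁺ˡ : ∀ A B {a} → a ∈ rightOpts A → a + B ∈ rightOpts (A + B)
rightOpts-+⁺ˡ (game _ AR) (game _ BR) = ∈-sum⁺ˡ AR BR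

rightOpts-+⁺ʳ : ∀ A B {b} → b ∈ rightOpts B → A + b ∈ rightOpts (A + B)
rightOpts-+⁺ʳ (game _ AR) (game _ BR) = ∈-sum⁺ʳ AR BR

options-+⁺ˡ : ∀ A B {a} → a ∈ options A → a + B ∈ options (A + B)
options-+⁺ˡ A@(game AL _) B@(game _ _) p with ∈-++⁻ AL p
... | inj₁ q = ∈-++⁺ˡ (leftOpts-+⁺ˡ A B q)
... | inj₂ q = ∈-++⁺ʳ (leftOpts (A + B)) (rightOpts-+⁺ˡ A B q)

leftOpts-+-[]⁻ : ∀ A B → leftOpts (A + B) ≡ [] → leftOpts A ≡ [] × leftOpts B ≡ []
leftOpts-+-[]⁻ (game [] _)      (game [] _)      _  = refl , refl
leftOpts-+-[]⁻ (game (_ ∷ _) _) (game _ _)       ()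
leftOpts-+-[]⁻ (game [] _)      (game (_ ∷ _) _) ()

rightOpts-+-[]⁻ : ∀ A B → rightOpts (A + B) ≡ [] → rightOpts A ≡ [] × rightOpts B ≡ []
rightOpts-+-[]⁻ (game _ [])      (game _ [])      _  = refl , refl
rightOpts-+-[]⁻ (game _ (_ ∷ _)) (game _ _)       ()
rightOpts-+-[]⁻ (game _ [])      (game _ (_ ∷ _)) ()

leftOpts-+-[]⁺ : ∀ A B → leftOpts A ≡ [] → leftOpts B ≡ [] → leftOpts (A + B) ≡ []
leftOpts-+-[]⁺ (game [] _) (game [] _) refl refl = refl

rightOpts-+-[]⁺ : ∀ A B → rightOpts A ≡ [] → rightOpts B ≡ [] → rightOpts (A + B) ≡ []
rightOpts-+-[]⁺ (game _ []) (game _ []) refl refl = refl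

+-≡𝟘⁻ : ∀ A B → A + B ≡ 𝟘 → A ≡ 𝟘 × B ≡ 𝟘
+-≡𝟘⁻ (game [] [])      (game [] [])      _  = refl , refl
+-≡𝟘⁻ (game (_ ∷ _) _)  (game _ _)        ()
+-≡𝟘⁻ (game [] (_ ∷ _)) (game _ _)        ()
+-≡𝟘⁻ (game [] [])      (game (_ ∷ _) _)  ()
+-≡𝟘⁻ (game [] [])      (game [] (_ ∷ _)) ()

mutual
  +-identityˡ-≡ : ∀ X → 𝟘 + X ≡ X
  +-identityˡ-≡ (game L R) = cong₂ game (sumR-𝟘 L) (sumR-𝟘 R)

  sumR-𝟘 : ∀ xs → sumR 𝟘 xs ≡ xs
  sumR-𝟘 []       = refl
  sumR-𝟘 (x ∷ xs) = cong₂ _∷_ (+-identityˡ-≡ x) (sumR-𝟘 xs)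

mutual
  +-identityʳ-≡ : ∀ X → X + 𝟘 ≡ X
  +-identityʳ-≡ (game L R) =
    cong₂ game (trans (++-identityʳ _) (sumL-𝟘 L)) (trans (++-identityʳ _) (sumL-𝟘 R))

  sumL-𝟘 : ∀ xs → sumL xs 𝟘 ≡ xs
  sumL-𝟘 []       = refl
  sumL-𝟘 (x ∷ xs) = cong₂ _∷_ (+-identityʳ-≡ x) (sumL-𝟘 xs)

-- Left dead ends and outcomes

allDeadEnd-∈ : ∀ xs {x} → AllLeftDeadEnd xs → x ∈ xs → LeftDeadEnd x
allDeadEnd-∈ (y ∷ ys) (d , _)  (here refl) = d
allDeadEnd-∈ (y ∷ ys) (_ , ds) (there p)   = allDeadEnd-∈ ys ds p

allDeadEnd-intro : ∀ xs → (∀ {x} → x ∈ xs → LeftDeadEnd x) → AllLeftDeadEnd xs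
allDeadEnd-intro []       f = tt
allDeadEnd-intro (x ∷ xs) f = f (here refl) , allDeadEnd-intro xs (f ∘ there)

deadEnd-leftOpts : ∀ G → LeftDeadEnd G → leftOpts G ≡ []
deadEnd-leftOpts (game [] _) _ = refl

deadEnd-∉leftOpts : ∀ G {x} → LeftDeadEnd G → ¬ x ∈ leftOpts G
deadEnd-∉leftOpts (game [] _) _ ()

deadEnd-rightOpt : ∀ G {x} → LeftDeadEnd G → x ∈ rightOpts G → LeftDeadEnd x
deadEnd-rightOpt (game [] R) = allDeadEnd-∈ R

deadEnd-option⇒rightOpt : ∀ G {x} → LeftDeadEnd G → x ∈ options G → x ∈ rightOpts G
deadEnd-option⇒rightOpt (game [] _) _ p = p

deadEnd-option : ∀ G {x} → LeftDeadEnd G → x ∈ options G → LeftDeadEnd x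
deadEnd-option G dG = deadEnd-rightOpt G dG ∘ deadEnd-option⇒rightOpt G dG

deadEnd-≡𝟘 : ∀ G → LeftDeadEnd G → rightOpts G ≡ [] → G ≡ 𝟘
deadEnd-≡𝟘 (game [] []) _ _ = refl

deadEnd-≢𝟘 : ∀ G → LeftDeadEnd G → G ≢ 𝟘 → ∃[ g ] g ∈ rightOpts G
deadEnd-≢𝟘 (game [] [])      _ G≢𝟘 = contradiction refl G≢𝟘
deadEnd-≢𝟘 (game [] (g ∷ _)) _ _   = g , here refl

deadEnd-+ : ∀ A B → LeftDeadEnd A → LeftDeadEnd B → LeftDeadEnd (A + B)
deadEnd-+ A B = go A B (◃-wellFounded (A + B))
  where
  go : ∀ A B → Acc _◃_ (A + B) → LeftDeadEnd A → LeftDeadEnd B → LeftDeadEnd (A + B)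
  go A@(game [] _) B@(game [] _) (acc rs) dA dB = allDeadEnd-intro _ option
    where
    option : ∀ {x} → x ∈ rightOpts (A + B) → LeftDeadEnd x
    option p with rightOpts-+⁻ A B p
    ... | moveˡ {a} q = go a B (rs (rightOpt⇒option (A + B) p)) (deadEnd-rightOpt A dA q) dB
    ... | moveʳ {b} q = go A b (rs (rightOpt⇒option (A + B) p)) dA (deadEnd-rightOpt B dB q)

LFany⁺ : ∀ {x xs} → x ∈ xs → ¬ RF x → LFany xs
LFany⁺ (here refl) ¬rf = inj₁ ¬rf
LFany⁺ (there p)   ¬rf = inj₂ (LFany⁺ p ¬rf)

LFany⁻ : ∀ xs → LFany xs → ∃[ x ] (x ∈ xs × ¬ RF x)
LFany⁻ (x ∷ xs) (inj₁ ¬rf) = x , here refl , ¬rf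
LFany⁻ (x ∷ xs) (inj₂ any) = let y , p , ¬rf = LFany⁻ xs any in y , there p , ¬rf

RFany⁺ : ∀ {x xs} → x ∈ xs → ¬ LF x → RFany xs
RFany⁺ (here refl) ¬lf = inj₁ ¬lf
RFany⁺ (there p)   ¬lf = inj₂ (RFany⁺ p ¬lf)

RFany⁻ : ∀ xs → RFany xs → ∃[ x ] (x ∈ xs × ¬ LF x)
RFany⁻ (x ∷ xs) (inj₁ ¬lf) = x , here refl , ¬lf
RFany⁻ (x ∷ xs) (inj₂ any) = let y , p , ¬lf = RFany⁻ xs any in y , there p , ¬lf

LF-noMove : ∀ G → leftOpts G ≡ [] → LF G
LF-noMove (game L R) = inj₁

LF-move : ∀ G {x} → x ∈ leftOpts G → ¬ RF x → LF G
LF-move (game L R) p ¬rf = inj₂ (LFany⁺ p ¬rf)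

LF-cases : ∀ G → LF G → leftOpts G ≡ [] ⊎ ∃[ x ] (x ∈ leftOpts G × ¬ RF x)
LF-cases (game L R) (inj₁ none) = inj₁ none
LF-cases (game L R) (inj₂ any)  = inj₂ (LFany⁻ L any)

RF-noMove : ∀ G → rightOpts G ≡ [] → RF G
RF-noMove (game L R) = inj₁

RF-move : ∀ G {x} → x ∈ rightOpts G → ¬ LF x → RF G
RF-move (game L R) p ¬lf = inj₂ (RFany⁺ p ¬lf)

RF-cases : ∀ G → RF G → rightOpts G ≡ [] ⊎ ∃[ x ] (x ∈ rightOpts G × ¬ LF x)
RF-cases (game L R) (inj₁ none) = inj₁ none
RF-cases (game L R) (inj₂ any)  = inj₂ (RFany⁻ R any)

deadEnd-¬RF : ∀ G → LeftDeadEnd G → G ≢ 𝟘 → ¬ RF G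
deadEnd-¬RF G dG G≢𝟘 rf with RF-cases G rf
... | inj₁ none          = G≢𝟘 (deadEnd-≡𝟘 G dG none)
... | inj₂ (x , p , ¬lf) = ¬lf (LF-noMove x (deadEnd-leftOpts x (deadEnd-rightOpt G dG p)))

-- Runs and races

terminalRun-exists : ∀ G → ∃[ k ] TerminalRun G k
terminalRun-exists (game [] [])      = 0 , refl
terminalRun-exists (game (x ∷ _) _)  = let k , t = terminalRun-exists x in suc k , x , here refl , t
terminalRun-exists (game [] (x ∷ _)) = let k , t = terminalRun-exists x in suc k , x , here refl , t

terminalRun? : ∀ G k → Dec (TerminalRun G k)
terminalRun? G zero    = ≡𝟘? G
terminalRun? G (suc k) =
  map′ find (λ (_ , p , t) → lose p t) (any? (λ G′ → terminalRun? G′ k) (options G))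

leastWitness : ∀ {P : ℕ → Set} → Decidable P → ∀ {n} → P n →
  ∃[ m ] (P m × (∀ k → P k → m ≤ k))
leastWitness P? {n} pn with P? 0
... | yes p0 = 0 , p0 , λ _ _ → z≤n
leastWitness P? {zero}  p0 | no ¬p0 = contradiction p0 ¬p0
leastWitness P? {suc n} pn | no ¬p0 =
  let m , pm , least = leastWitness (P? ∘ suc) pn in
  suc m , pm , λ { zero p0 → contradiction p0 ¬p0 ; (suc k) pk → s≤s (least k pk) }

race-exists : ∀ G → ∃[ r ] IsRace G r
race-exists G = leastWitness (terminalRun? G) (proj₂ (terminalRun-exists G))

race-unique : ∀ {r s} → IsRace G r → IsRace G s → r ≡ s
race-unique {r = r} {s} (runR , minR) (runS , minS) = ℕ.≤-antisym (minR s runS) (minS r runR)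

terminalRun-+ : ∀ A B {a b} → TerminalRun A a → TerminalRun B b → TerminalRun (A + B) (a +ℕ b)
terminalRun-+ A B {zero} {b} refl runB = subst (λ Z → TerminalRun Z b) (sym (+-identityˡ-≡ B)) runB
terminalRun-+ A B {suc a} (A′ , p , runA′) runB =
  A′ + B , options-+⁺ˡ A B p , terminalRun-+ A′ B runA′ runB

terminalRun-+⁻ : ∀ A B k → TerminalRun (A + B) k →
  ∃₂ λ a b → a +ℕ b ≡ k × TerminalRun A a × TerminalRun B b
terminalRun-+⁻ A B zero A+B≡𝟘 =
  let A≡𝟘 , B≡𝟘 = +-≡𝟘⁻ A B A+B≡𝟘 in 0 , 0 , refl , A≡𝟘 , B≡𝟘
terminalRun-+⁻ A B (suc k) (_ , p , run) with options-+⁻ A B p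
... | moveˡ {A′} q = let a , b , a+b≡k , runA , runB = terminalRun-+⁻ A′ B k run in
  suc a , b , cong suc a+b≡k , (A′ , q , runA) , runB
... | moveʳ {B′} q = let a , b , a+b≡k , runA , runB = terminalRun-+⁻ A B′ k run in
  a , suc b , trans (ℕ.+-suc a b) (cong suc a+b≡k) , runA , (B′ , q , runB)

race-+ : ∀ A B {ra rb} → IsRace A ra → IsRace B rb → IsRace (A + B) (ra +ℕ rb)
race-+ A B {ra} {rb} (runA , minA) (runB , minB) = terminalRun-+ A B runA runB , minimal
  where
  minimal : ∀ k → TerminalRun (A + B) k → ra +ℕ rb ≤ k
  minimal k run with terminalRun-+⁻ A B k run
  ... | a , b , refl , runA′ , runB′ = ℕ.+-mono-≤ (minA a runA′) (minB b runB′)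

-- Comparing Left dead ends by their Right options

infix 4 _⊒_

-- On Left dead ends this is exactly ≥ (⊒⇒≥, ≥⇒⊒).
data _⊒_ : Game → Game → Set where
  ⊒-intro : ∀ {G H} →
    (rightOpts G ≡ [] → rightOpts H ≡ []) →
    (∀ {g} → g ∈ rightOpts G → ∃[ h ] (h ∈ rightOpts H × g ⊒ h)) →
    G ⊒ H

⊒-leaf : G ⊒ H → rightOpts G ≡ [] → rightOpts H ≡ []
⊒-leaf (⊒-intro leaf _) = leaf

⊒-match : ∀ {g} → G ⊒ H → g ∈ rightOpts G → ∃[ h ] (h ∈ rightOpts H × g ⊒ h)
⊒-match (⊒-intro _ match) = match

⊒-refl : ∀ G → G ⊒ G
⊒-refl G = go (◃-wellFounded G)
  where
  go : ∀ {G} → Acc _◃_ G → G ⊒ G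
  go {G} (acc rs) = ⊒-intro id λ {g} p → g , p , go (rs (rightOpt⇒option G p))

⊒-trans : ∀ {K} → G ⊒ H → H ⊒ K → G ⊒ K
⊒-trans {G} {H} {K} (⊒-intro leaf match) (⊒-intro leaf′ match′) = ⊒-intro (leaf′ ∘ leaf) chain
  where
  chain : ∀ {g} → g ∈ rightOpts G → ∃[ k ] (k ∈ rightOpts K × g ⊒ k)
  chain p with match p
  ... | h , q , g⊒h with match′ q
  ...   | k , r , h⊒k = k , r , ⊒-trans g⊒h h⊒k

≡[]? : ∀ {A : Set} (xs : List A) → Dec (xs ≡ [])
≡[]? []      = yes refl
≡[]? (_ ∷ _) = no λ ()

mutual
  _⊒?_ : ∀ G H → Dec (G ⊒ H)
  game _ GR ⊒? game _ HR =
    map′ (λ (leaf , all) → ⊒-intro leaf (lookup all)) (λ d → ⊒-leaf d , tabulate (⊒-match d))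
      ((≡[]? GR →-dec ≡[]? HR) ×-dec matchAll? GR HR)

  matchAll? : ∀ gs hs → Dec (All (λ g → ∃[ h ] (h ∈ hs × g ⊒ h)) gs)
  matchAll? []       hs = yes []
  matchAll? (g ∷ gs) hs = map′ (uncurry _∷_) uncons (match? g hs ×-dec matchAll? gs hs)

  match? : ∀ g hs → Dec (∃[ h ] (h ∈ hs × g ⊒ h))
  match? g hs = map′ find (λ (_ , p , g⊒h) → lose p g⊒h) (any? (g ⊒?_) hs)

+-monoˡ-⊒ : ∀ J → A ⊒ B → A + J ⊒ B + J
+-monoˡ-⊒ {A} J = go A J (◃-wellFounded (A + J))
  where
  go : ∀ A J {B} → Acc _◃_ (A + J) → A ⊒ B → A + J ⊒ B + J
  go A J {B} (acc rs) A⊒B = ⊒-intro leaf match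
    where
    leaf : rightOpts (A + J) ≡ [] → rightOpts (B + J) ≡ []
    leaf none = let noA , noJ = rightOpts-+-[]⁻ A J none in rightOpts-+-[]⁺ B J (⊒-leaf A⊒B noA) noJ
    match : ∀ {x} → x ∈ rightOpts (A + J) → ∃[ y ] (y ∈ rightOpts (B + J) × x ⊒ y)
    match p with rightOpts-+⁻ A J p
    ... | moveˡ {a} q = let b , r , a⊒b = ⊒-match A⊒B q in
      b + J , rightOpts-+⁺ˡ B J r , go a J (rs (rightOpt⇒option (A + J) p)) a⊒b
    ... | moveʳ {j} q = B + j , rightOpts-+⁺ʳ B J q , go A j (rs (rightOpt⇒option (A + J) p)) A⊒B

+-comm-⊒ : ∀ A B → A + B ⊒ B + A
+-comm-⊒ A B = go A B (◃-wellFounded (A + B))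
  where
  go : ∀ A B → Acc _◃_ (A + B) → A + B ⊒ B + A
  go A B (acc rs) = ⊒-intro leaf match
    where
    leaf : rightOpts (A + B) ≡ [] → rightOpts (B + A) ≡ []
    leaf none = let noA , noB = rightOpts-+-[]⁻ A B none in rightOpts-+-[]⁺ B A noB noA
    match : ∀ {x} → x ∈ rightOpts (A + B) → ∃[ y ] (y ∈ rightOpts (B + A) × x ⊒ y)
    match p with rightOpts-+⁻ A B p
    ... | moveˡ {a} q = B + a , rightOpts-+⁺ʳ B A q , go a B (rs (rightOpt⇒option (A + B) p))
    ... | moveʳ {b} q = b + A , rightOpts-+⁺ˡ B A q , go A b (rs (rightOpt⇒option (A + B) p))

+-assoc-⊒ : ∀ A B C → (A + B) + C ⊒ A + (B + C)
+-assoc-⊒ A B C = go A B C (◃-wellFounded ((A + B) + C))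
  where
  go : ∀ A B C → Acc _◃_ ((A + B) + C) → (A + B) + C ⊒ A + (B + C)
  go A B C (acc rs) = ⊒-intro leaf match
    where
    option : ∀ {x} → x ∈ rightOpts ((A + B) + C) → x ◃ (A + B) + C
    option = rightOpt⇒option ((A + B) + C)
    leaf : rightOpts ((A + B) + C) ≡ [] → rightOpts (A + (B + C)) ≡ []
    leaf none =
      let noAB , noC = rightOpts-+-[]⁻ (A + B) C none
          noA , noB  = rightOpts-+-[]⁻ A B noAB
      in rightOpts-+-[]⁺ A (B + C) noA (rightOpts-+-[]⁺ B C noB noC)
    match : ∀ {x} → x ∈ rightOpts ((A + B) + C) → ∃[ y ] (y ∈ rightOpts (A + (B + C)) × x ⊒ y)
    match p with rightOpts-+⁻ (A + B) C p
    ... | moveʳ {c} q =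
      A + (B + c) , rightOpts-+⁺ʳ A (B + C) (rightOpts-+⁺ʳ B C q) , go A B c (rs (option p))
    ... | moveˡ q with rightOpts-+⁻ A B q
    ...   | moveˡ {a} r =
      a + (B + C) , rightOpts-+⁺ˡ A (B + C) r , go a B C (rs (option p))
    ...   | moveʳ {b} r =
      A + (b + C) , rightOpts-+⁺ʳ A (B + C) (rightOpts-+⁺ˡ B C r) , go A b C (rs (option p))

+-assoc⁻-⊒ : ∀ A B C → A + (B + C) ⊒ (A + B) + C
+-assoc⁻-⊒ A B C =
  ⊒-trans (+-comm-⊒ A (B + C)) (⊒-trans (+-assoc-⊒ B C A) (⊒-trans (+-comm-⊒ B (C + A))
    (⊒-trans (+-assoc-⊒ C A B) (+-comm-⊒ C (A + B)))))

infix 4 _≋_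

_≋_ : Game → Game → Set
G ≋ H = G ⊒ H × H ⊒ G

≋-isEquivalence : IsEquivalence _≋_
≋-isEquivalence = record
  { refl  = λ {G} → ⊒-refl G , ⊒-refl G
  ; sym   = λ (G⊒H , H⊒G) → H⊒G , G⊒H
  ; trans = λ (G⊒H , H⊒G) (H⊒K , K⊒H) → ⊒-trans G⊒H H⊒K , ⊒-trans K⊒H H⊒G
  }

≋-setoid : Setoid _ _
≋-setoid = record { isEquivalence = ≋-isEquivalence }

open Setoid ≋-setoid using () renaming (refl to ≋-refl; sym to ≋-sym; trans to ≋-trans)

≡⇒≋ : G ≡ H → G ≋ H
≡⇒≋ refl = ≋-refl

+-mono-⊒ : A ⊒ B → C ⊒ H → A + C ⊒ B + H
+-mono-⊒ {A} {B} {C} {H} A⊒B C⊒H =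
  ⊒-trans (+-monoˡ-⊒ C A⊒B)
    (⊒-trans (+-comm-⊒ B C) (⊒-trans (+-monoˡ-⊒ B C⊒H) (+-comm-⊒ H B)))

+-≋-isCommutativeMonoid : IsCommutativeMonoid _≋_ _+_ 𝟘
+-≋-isCommutativeMonoid = record
  { isMonoid = record
    { isSemigroup = record
      { isMagma = record
        { isEquivalence = ≋-isEquivalence
        ; ∙-cong        = λ (A⊒B , B⊒A) (C⊒H , H⊒C) →
                            +-mono-⊒ A⊒B C⊒H , +-mono-⊒ B⊒A H⊒C
        }
      ; assoc = λ A B C → +-assoc-⊒ A B C , +-assoc⁻-⊒ A B C
      }
    ; identity = ≡⇒≋ ∘ +-identityˡ-≡ , ≡⇒≋ ∘ +-identityʳ-≡
    }
  ; comm = λ A B → +-comm-⊒ A B , +-comm-⊒ B A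
  }

+-≋-commutativeMonoid : CommutativeMonoid _ _
+-≋-commutativeMonoid = record { isCommutativeMonoid = +-≋-isCommutativeMonoid }

open CommutativeMonoid +-≋-commutativeMonoid
  using ()
  renaming (∙-cong to +-cong-≋; ∙-congˡ to +-congˡ-≋; assoc to +-assoc-≋; comm to +-comm-≋)
open import Algebra.Properties.CommutativeSemigroup
  (CommutativeMonoid.commutativeSemigroup +-≋-commutativeMonoid) using (x∙yz≈y∙xz)

mutual
  ⊒-LF : ∀ G H X → Acc _◃_ (G + X) → LeftDeadEnd G → LeftDeadEnd H → G ⊒ H →
    LF (H + X) → LF (G + X)
  ⊒-LF G H X (acc rs) dG dH G⊒H lf with LF-cases (H + X) lf
  ... | inj₁ none =
    LF-noMove (G + X) (leftOpts-+-[]⁺ G X (deadEnd-leftOpts G dG) (proj₂ (leftOpts-+-[]⁻ H X none)))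
  ... | inj₂ (_ , p , ¬rf) with leftOpts-+⁻ H X p
  ...   | moveˡ q     = contradiction q (deadEnd-∉leftOpts H dH)
  ...   | moveʳ {b} q =
    LF-move (G + X) G+b∈ (¬rf ∘ ⊒-RF G H b (rs (leftOpt⇒option (G + X) G+b∈)) dG dH G⊒H)
    where
    G+b∈ : G + b ∈ leftOpts (G + X)
    G+b∈ = leftOpts-+⁺ʳ G X q

  ⊒-RF : ∀ G H X → Acc _◃_ (G + X) → LeftDeadEnd G → LeftDeadEnd H → G ⊒ H →
    RF (G + X) → RF (H + X)
  ⊒-RF G H X (acc rs) dG dH G⊒H rf with RF-cases (G + X) rf
  ... | inj₁ none =
    let noG , noX = rightOpts-+-[]⁻ G X none in
    RF-noMove (H + X) (rightOpts-+-[]⁺ H X (⊒-leaf G⊒H noG) noX)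
  ... | inj₂ (_ , p , ¬lf) with rightOpts-+⁻ G X p
  ...   | moveˡ {g} q =
    let h , h∈ , g⊒h = ⊒-match G⊒H q in
    RF-move (H + X) (rightOpts-+⁺ˡ H X h∈) (¬lf ∘ ⊒-LF g h X (rs (rightOpt⇒option (G + X) p))
      (deadEnd-rightOpt G dG q) (deadEnd-rightOpt H dH h∈) g⊒h)
  ...   | moveʳ {b} q =
    RF-move (H + X) (rightOpts-+⁺ʳ H X q)
      (¬lf ∘ ⊒-LF G H b (rs (rightOpt⇒option (G + X) p)) dG dH G⊒H)

⊒⇒≥ : ∀ {G H} → LeftDeadEnd G → LeftDeadEnd H → G ⊒ H → G ≥ H
⊒⇒≥ {G} {H} dG dH G⊒H X =
  ⊒-LF G H X (◃-wellFounded (G + X)) dG dH G⊒H , ⊒-RF G H X (◃-wellFounded (G + X)) dG dH G⊒H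

leftInteger : ℕ → Game
leftInteger zero    = 𝟘
leftInteger (suc n) = game (leftInteger n ∷ []) []

leftInteger-rightOpts : ∀ n → rightOpts (leftInteger n) ≡ []
leftInteger-rightOpts zero    = refl
leftInteger-rightOpts (suc n) = refl

-- Right, moving first, follows a terminal run of g while Left burns the moves of the integer.
RF-+-leftInteger : ∀ g {k} n → LeftDeadEnd g → TerminalRun g k → k ≤ n → RF (g + leftInteger n)
RF-+-leftInteger g {zero} n _ refl _ =
  RF-noMove (𝟘 + leftInteger n) (rightOpts-+-[]⁺ 𝟘 (leftInteger n) refl (leftInteger-rightOpts n))
RF-+-leftInteger g {suc k} (suc n) dg (g′ , p , t) (s≤s k≤n) =
  RF-move (g + leftInteger (suc n)) (rightOpts-+⁺ˡ g (leftInteger (suc n)) g′∈) ¬LF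
  where
  g′∈ : g′ ∈ rightOpts g
  g′∈ = deadEnd-option⇒rightOpt g dg p
  dg′ : LeftDeadEnd g′
  dg′ = deadEnd-rightOpt g dg g′∈
  ¬LF : ¬ LF (g′ + leftInteger (suc n))
  ¬LF lf with LF-cases (g′ + leftInteger (suc n)) lf
  ... | inj₁ none = case proj₂ (leftOpts-+-[]⁻ g′ (leftInteger (suc n)) none) of λ ()
  ... | inj₂ (_ , q , ¬rf) with leftOpts-+⁻ g′ (leftInteger (suc n)) q
  ...   | moveˡ r         = deadEnd-∉leftOpts g′ dg′ r
  ...   | moveʳ (here refl) = ¬rf (RF-+-leftInteger g′ n dg′ t k≤n)

Separates : Game → Game → Game → Set
Separates X G H = RF (G + X) × ¬ RF (H + X)

separate-𝟘-nonzero : ∀ H → LeftDeadEnd H → H ≢ 𝟘 → ∃[ X ] Separates X 𝟘 H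
separate-𝟘-nonzero H dH H≢𝟘 = X , RF-move (𝟘 + X) (here refl) ¬LF-one , ¬RF
  where
  one : Game
  one = leftInteger 1
  X : Game
  X = game [] (one ∷ [])
  ¬LF-one : ¬ LF one
  ¬LF-one lf with LF-cases one lf
  ... | inj₂ (_ , here refl , ¬rf) = ¬rf (RF-noMove 𝟘 refl)
  ¬RF : ¬ RF (H + X)
  ¬RF rf with RF-cases (H + X) rf
  ... | inj₁ none = H≢𝟘 (deadEnd-≡𝟘 H dH (proj₁ (rightOpts-+-[]⁻ H X none)))
  ... | inj₂ (_ , p , ¬lf) with rightOpts-+⁻ H X p
  ...   | moveˡ {h} q =
    ¬lf (LF-noMove (h + X) (leftOpts-+-[]⁺ h X (deadEnd-leftOpts h (deadEnd-rightOpt H dH q)) refl))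
  ...   | moveʳ (here refl) =
    ¬lf (LF-move (H + one) (leftOpts-+⁺ʳ H one (here refl))
      (subst (¬_ ∘ RF) (sym (+-identityʳ-≡ H)) (deadEnd-¬RF H dH H≢𝟘)))

separate-nonzero-𝟘 : ∀ G → LeftDeadEnd G → G ≢ 𝟘 → ∃[ X ] Separates X G 𝟘
separate-nonzero-𝟘 G dG G≢𝟘 with terminalRun-exists G
... | zero , G≡𝟘 = contradiction G≡𝟘 G≢𝟘
... | suc k , g , p , t = X , RF-move (G + X) (rightOpts-+⁺ˡ G X g∈) ¬LF , ¬RF
  where
  X : Game
  X = game (leftInteger k ∷ []) (𝟘 ∷ [])
  g∈ : g ∈ rightOpts G
  g∈ = deadEnd-option⇒rightOpt G dG p
  dg : LeftDeadEnd g
  dg = deadEnd-rightOpt G dG g∈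
  ¬LF : ¬ LF (g + X)
  ¬LF lf with LF-cases (g + X) lf
  ... | inj₁ none = case proj₂ (leftOpts-+-[]⁻ g X none) of λ ()
  ... | inj₂ (_ , q , ¬rf) with leftOpts-+⁻ g X q
  ...   | moveˡ r           = deadEnd-∉leftOpts g dg r
  ...   | moveʳ (here refl) = ¬rf (RF-+-leftInteger g k dg t ℕ.≤-refl)
  ¬RF : ¬ RF (𝟘 + X)
  ¬RF rf with RF-cases (𝟘 + X) rf
  ... | inj₂ (_ , here refl , ¬lf) = ¬lf (LF-noMove 𝟘 refl)

separate-via-rightOpt : ∀ G H {g} → LeftDeadEnd G → LeftDeadEnd H → H ≢ 𝟘 → g ∈ rightOpts G →
  (∀ {h} → h ∈ rightOpts H → ∃[ Y ] Separates Y g h) → ∃[ X ] Separates X G H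
separate-via-rightOpt G H {g} dG dH H≢𝟘 g∈ separator =
  X , RF-move (G + X) (rightOpts-+⁺ˡ G X g∈) ¬LF , ¬RF
  where
  dg : LeftDeadEnd g
  dg = deadEnd-rightOpt G dG g∈
  X : Game
  X = game (mapWith∈ (rightOpts H) (proj₁ ∘ separator)) []
  ¬LF : ¬ LF (g + X)
  ¬LF lf with LF-cases (g + X) lf
  ... | inj₁ none =
    let h , h∈ = deadEnd-≢𝟘 H dH H≢𝟘 in
    case subst (proj₁ (separator h∈) ∈_) (proj₂ (leftOpts-+-[]⁻ g X none))
           (mapWith∈⁺ _ (h , h∈ , refl)) of λ ()
  ... | inj₂ (_ , q , ¬rf) with leftOpts-+⁻ g X q
  ...   | moveˡ r = deadEnd-∉leftOpts g dg r
  ...   | moveʳ r with mapWith∈⁻ (rightOpts H) (proj₁ ∘ separator) r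
  ...     | h , h∈ , refl = ¬rf (proj₁ (proj₂ (separator h∈)))
  ¬RF : ¬ RF (H + X)
  ¬RF rf with RF-cases (H + X) rf
  ... | inj₁ none = H≢𝟘 (deadEnd-≡𝟘 H dH (proj₁ (rightOpts-+-[]⁻ H X none)))
  ... | inj₂ (_ , p , ¬lf) with rightOpts-+⁻ H X p
  ...   | moveˡ {h} q =
    ¬lf (LF-move (h + X) (leftOpts-+⁺ʳ h X (mapWith∈⁺ _ (h , q , refl)))
      (proj₂ (proj₂ (separator q))))

separate : ∀ G H → LeftDeadEnd G → LeftDeadEnd H → ¬ G ⊒ H → ∃[ X ] Separates X G H
separate G H = go G H (◃-wellFounded G)
  where
  go : ∀ G H → Acc _◃_ G → LeftDeadEnd G → LeftDeadEnd H → ¬ G ⊒ H → ∃[ X ] Separates X G H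
  go G H (acc rs) dG dH G⋣H with ≡𝟘? G | ≡𝟘? H
  ... | yes refl | yes refl = contradiction (⊒-refl 𝟘) G⋣H
  ... | yes refl | no H≢𝟘   = separate-𝟘-nonzero H dH H≢𝟘
  ... | no G≢𝟘   | yes refl = separate-nonzero-𝟘 G dG G≢𝟘
  ... | no G≢𝟘   | no H≢𝟘   =
    let g , g∈ , unmatched = find (¬All⇒Any¬ (λ g → match? g (rightOpts H)) (rightOpts G) ¬allMatched)
        dg = deadEnd-rightOpt G dG g∈
    in separate-via-rightOpt G H dG dH H≢𝟘 g∈ λ {h} h∈ →
         go g h (rs (rightOpt⇒option G g∈)) dg (deadEnd-rightOpt H dH h∈)
           (unmatched ∘ (h ,_) ∘ (h∈ ,_))
    where
    ¬allMatched : ¬ All (λ g → ∃[ h ] (h ∈ rightOpts H × g ⊒ h)) (rightOpts G)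
    ¬allMatched all =
      G⋣H (⊒-intro (λ noG → contradiction (deadEnd-≡𝟘 G dG noG) G≢𝟘) (lookup all))

≥⇒⊒ : ∀ {G H} → LeftDeadEnd G → LeftDeadEnd H → G ≥ H → G ⊒ H
≥⇒⊒ {G} {H} dG dH G≥H with G ⊒? H
... | yes G⊒H = G⊒H
... | no G⋣H  = let X , rf , ¬rf = separate G H dG dH G⋣H in contradiction (proj₂ (G≥H X) rf) ¬rf

≋⇒≈ : ∀ {G H} → LeftDeadEnd G → LeftDeadEnd H → G ≋ H → G ≈ H
≋⇒≈ dG dH (G⊒H , H⊒G) = ⊒⇒≥ dG dH G⊒H , ⊒⇒≥ dH dG H⊒G

≈⇒≋ : ∀ {G H} → LeftDeadEnd G → LeftDeadEnd H → G ≈ H → G ≋ H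
≈⇒≋ dG dH (G≥H , H≥G) = ≥⇒⊒ dG dH G≥H , ≥⇒⊒ dH dG H≥G

⊒-terminalRun : ∀ G H k → LeftDeadEnd G → LeftDeadEnd H → G ⊒ H →
  TerminalRun G k → TerminalRun H k
⊒-terminalRun G H zero    dG dH G⊒H refl          = deadEnd-≡𝟘 H dH (⊒-leaf G⊒H refl)
⊒-terminalRun G H (suc k) dG dH G⊒H (g , p , run) =
  let g∈ = deadEnd-option⇒rightOpt G dG p
      h , h∈ , g⊒h = ⊒-match G⊒H g∈
  in h , rightOpt⇒option H h∈ ,
     ⊒-terminalRun g h k (deadEnd-rightOpt G dG g∈) (deadEnd-rightOpt H dH h∈) g⊒h run

race-resp-≋ : ∀ {G H r} → LeftDeadEnd G → LeftDeadEnd H → G ≋ H → IsRace G r → IsRace H r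
race-resp-≋ {G} {H} {r} dG dH (G⊒H , H⊒G) (run , minimal) =
  ⊒-terminalRun G H r dG dH G⊒H run , λ k → minimal k ∘ ⊒-terminalRun H G k dH dG H⊒G

-- Cancellation

+-cancelʳ-⊒-𝟘 : ∀ Y P → LeftDeadEnd Y → LeftDeadEnd P → 𝟘 + P ⊒ Y + P → Y ≡ 𝟘
+-cancelʳ-⊒-𝟘 Y P dY dP 𝟘+P⊒Y+P with race-exists Y | race-exists P
... | zero   , Y≡𝟘 , _  | _                    = Y≡𝟘
... | suc ry , raceY    | rp , raceP@(runP , _) =
  contradiction (proj₂ (race-+ Y P raceY raceP) rp runY+P) (ℕ.<⇒≱ (ℕ.m<n+m rp (s≤s z≤n)))
  where
  runY+P : TerminalRun (Y + P) rp
  runY+P = ⊒-terminalRun (𝟘 + P) (Y + P) rp (deadEnd-+ 𝟘 P tt dP) (deadEnd-+ Y P dY dP) 𝟘+P⊒Y+P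
             (subst (λ Z → TerminalRun Z rp) (sym (+-identityˡ-≡ P)) runP)

mutual
  +-cancelʳ-⊒ : ∀ X Y P → LeftDeadEnd X → LeftDeadEnd Y → LeftDeadEnd P →
    X + P ⊒ Y + P → X ⊒ Y
  +-cancelʳ-⊒ X Y P dX dY dP X+P⊒Y+P@(⊒-intro _ match) = ⊒-intro leaf match′
    where
    leaf : rightOpts X ≡ [] → rightOpts Y ≡ []
    leaf noX = cong rightOpts (+-cancelʳ-⊒-𝟘 Y P dY dP
      (subst (λ Z → Z + P ⊒ Y + P) (deadEnd-≡𝟘 X dX noX) X+P⊒Y+P))
    match′ : ∀ {x} → x ∈ rightOpts X → ∃[ y ] (y ∈ rightOpts Y × x ⊒ y)
    match′ {x} x∈ with match (rightOpts-+⁺ˡ X P x∈)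
    ... | c , c∈ , x+P⊒c = chase x Y P (deadEnd-rightOpt X dX x∈) dY dP x+P⊒c (rightOpts-+⁻ Y P c∈)

  -- The match c of x + P is either y + P, and P is cancelled recursively, or Y + p, and then
  -- x + p must be matched once more, one level further down in P.
  chase : ∀ x Y P {c} → LeftDeadEnd x → LeftDeadEnd Y → LeftDeadEnd P → x + P ⊒ c →
    SummandMove Y P (rightOpts Y) (rightOpts P) c → ∃[ y ] (y ∈ rightOpts Y × x ⊒ y)
  chase x Y P dx dY dP x+P⊒y+P (moveˡ {y} y∈) =
    y , y∈ , +-cancelʳ-⊒ x y P dx (deadEnd-rightOpt Y dY y∈) dP x+P⊒y+P
  chase x Y P dx dY dP (⊒-intro _ match) (moveʳ {p} p∈) with match (rightOpts-+⁺ʳ x P p∈)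
  ... | c , c∈ , x+p⊒c = chase x Y p dx dY (deadEnd-rightOpt P dP p∈) x+p⊒c (rightOpts-+⁻ Y p c∈)

+-cancelˡ-≈ : ∀ H K K′ → LeftDeadEnd H → LeftDeadEnd K → LeftDeadEnd K′ →
  H + K ≈ H + K′ → K ≈ K′
+-cancelˡ-≈ H K K′ dH dK dK′ H+K≈H+K′ =
  ≋⇒≈ dK dK′
    (+-cancelʳ-⊒ K K′ H dK dK′ dH (proj₁ K+H≋K′+H) , +-cancelʳ-⊒ K′ K H dK′ dK dH (proj₂ K+H≋K′+H))
  where
  K+H≋K′+H : K + H ≋ K′ + H
  K+H≋K′+H = ≋-trans (+-comm-≋ K H)
    (≋-trans (≈⇒≋ (deadEnd-+ H K dH dK) (deadEnd-+ H K′ dH dK′) H+K≈H+K′) (+-comm-≋ H K′))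

-- Factorisations

sumList-deadEnd : AllAtoms As → LeftDeadEnd (sumList As)
sumList-deadEnd []                         = tt
sumList-deadEnd {A ∷ As} (atomA ∷ atomsAs) =
  deadEnd-+ A (sumList As) (proj₁ atomA) (sumList-deadEnd atomsAs)

AllAtoms-++ : AllAtoms as → AllAtoms bs → AllAtoms (as ++ bs)
AllAtoms-++ []               atomsBs = atomsBs
AllAtoms-++ (atomA ∷ atomsAs) atomsBs = atomA ∷ AllAtoms-++ atomsAs atomsBs

AllAtoms-middle : ∀ before {a after} → AllAtoms (before ++ a ∷ after) →
  IsAtom a × AllAtoms (before ++ after)
AllAtoms-middle []           (atomA ∷ atoms) = atomA , atoms
AllAtoms-middle (_ ∷ before) (atomB ∷ atoms) =
  let atomA , rest = AllAtoms-middle before atoms in atomA , atomB ∷ rest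

sumList-++ : ∀ as bs → sumList (as ++ bs) ≋ sumList as + sumList bs
sumList-++ []       bs = ≋-sym (≡⇒≋ (+-identityˡ-≡ (sumList bs)))
sumList-++ (a ∷ as) bs =
  ≋-trans (+-congˡ-≋ (sumList-++ as bs)) (≋-sym (+-assoc-≋ a (sumList as) (sumList bs)))

sumList-middle : ∀ before a after → sumList (before ++ a ∷ after) ≋ a + sumList (before ++ after)
sumList-middle before a after = begin
  sumList (before ++ a ∷ after)           ≈⟨ sumList-++ before (a ∷ after) ⟩
  sumList before + (a + sumList after)    ≈⟨ x∙yz≈y∙xz (sumList before) a (sumList after) ⟩
  a + (sumList before + sumList after)    ≈⟨ +-congˡ-≋ (sumList-++ before after) ⟨
  a + sumList (before ++ after)           ∎
  where open SetoidReasoning ≋-setoid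

sumList-factorisation : AllAtoms As → IsFactorisation (sumList As) As
sumList-factorisation atoms = atoms , ≈-refl

atom-factorisation : IsAtom A → IsFactorisation A [ A ]
atom-factorisation {A} atomA = atomA ∷ [] , subst (A ≈_) (sym (+-identityʳ-≡ A)) ≈-refl

factorisation-resp-≋ : ∀ {X} → LeftDeadEnd X → LeftDeadEnd Y → X ≋ Y →
  IsFactorisation Y As → IsFactorisation X As
factorisation-resp-≋ dX dY X≋Y (atoms , Y≈ΣAs) = atoms , ≈-trans (≋⇒≈ dX dY X≋Y) Y≈ΣAs

factorisation-+ : ∀ X Y {Xs Ys} → LeftDeadEnd X → LeftDeadEnd Y →
  IsFactorisation X Xs → IsFactorisation Y Ys → IsFactorisation (X + Y) (Xs ++ Ys)
factorisation-+ X Y {Xs} {Ys} dX dY (atomsX , X≈ΣXs) (atomsY , Y≈ΣYs) =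
  atoms , ≋⇒≈ (deadEnd-+ X Y dX dY) (sumList-deadEnd atoms) (begin
    X + Y                    ≈⟨ +-cong-≋ (≈⇒≋ dX (sumList-deadEnd atomsX) X≈ΣXs)
                                         (≈⇒≋ dY (sumList-deadEnd atomsY) Y≈ΣYs) ⟩
    sumList Xs + sumList Ys  ≈⟨ sumList-++ Xs Ys ⟨
    sumList (Xs ++ Ys)       ∎)
  where
  atoms : AllAtoms (Xs ++ Ys)
  atoms = AllAtoms-++ atomsX atomsY
  open SetoidReasoning ≋-setoid

⊒𝟘⇒≡𝟘 : ∀ X → LeftDeadEnd X → X ⊒ 𝟘 → X ≡ 𝟘
⊒𝟘⇒≡𝟘 (game [] [])      _ _   = refl
⊒𝟘⇒≡𝟘 (game [] (_ ∷ _)) _ X⊒𝟘 = case ⊒-match X⊒𝟘 (here refl) of λ { (_ , () , _) }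

≥𝟘⇒≡𝟘 : ∀ X → LeftDeadEnd X → X ≥ 𝟘 → X ≡ 𝟘
≥𝟘⇒≡𝟘 X dX = ⊒𝟘⇒≡𝟘 X dX ∘ ≥⇒⊒ dX tt

factorisation-nonempty : ∀ X {Xs} → LeftDeadEnd X → X ≢ 𝟘 → IsFactorisation X Xs → 0 < length Xs
factorisation-nonempty X {[]}    dX X≢𝟘 (_ , X≈𝟘) = contradiction (≥𝟘⇒≡𝟘 X dX (proj₁ X≈𝟘)) X≢𝟘
factorisation-nonempty X {_ ∷ _} _  _   _         = s≤s z≤n

race-positive : ∀ X {r} → IsRace X r → X ≢ 𝟘 → 0 < r
race-positive X {zero}  (X≡𝟘 , _) X≢𝟘 = contradiction X≡𝟘 X≢𝟘
race-positive X {suc r} _         _   = s≤s z≤n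

Factorisable : Game → Set
Factorisable X = ∃[ Xs ] IsFactorisation X Xs

-- Constructively only the double negation: whether a dead end is an atom need not be decidable.
¬¬-factorisable : ∀ X → LeftDeadEnd X → ¬ ¬ Factorisable X
¬¬-factorisable X dX = let r , raceX = race-exists X in go X (<-wellFounded r) dX raceX
  where
  go : ∀ X {r} → Acc _<_ r → LeftDeadEnd X → IsRace X r → ¬ ¬ Factorisable X
  go X {r} (acc rs) dX raceX unfactorisable with ≡𝟘? X
  ... | yes refl = unfactorisable ([] , [] , ≈-refl)
  ... | no X≢𝟘   =
    unfactorisable ([ X ] , atom-factorisation (dX , X≢𝟘 ∘ ≥𝟘⇒≡𝟘 X dX ∘ proj₁ , irreducible))
    where
    irreducible : ∀ Y Z → LeftDeadEnd Y → LeftDeadEnd Z → X ≈ Y + Z → Y ≈ 𝟘 ⊎ Z ≈ 𝟘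
    irreducible Y Z dY dZ X≈Y+Z with ≡𝟘? Y | ≡𝟘? Z
    ... | yes refl | _        = inj₁ ≈-refl
    ... | no _     | yes refl = inj₂ ≈-refl
    ... | no Y≢𝟘   | no Z≢𝟘   with race-exists Y | race-exists Z
    ...   | ry , raceY | rz , raceZ =
      ⊥-elim (go Y (rs ry<r) dY raceY λ (Ys , fY) → go Z (rs rz<r) dZ raceZ λ (Zs , fZ) →
        unfactorisable (Ys ++ Zs , factorisation-resp-≋ dX dY+Z X≋Y+Z (factorisation-+ Y Z dY dZ fY fZ)))
      where
      dY+Z : LeftDeadEnd (Y + Z)
      dY+Z = deadEnd-+ Y Z dY dZ
      X≋Y+Z : X ≋ Y + Z
      X≋Y+Z = ≈⇒≋ dX dY+Z X≈Y+Z
      r≡ry+rz : r ≡ ry +ℕ rz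
      r≡ry+rz = race-unique raceX (race-resp-≋ dY+Z dX (≋-sym X≋Y+Z) (race-+ Y Z raceY raceZ))
      ry<r : ry < r
      ry<r = subst (ry <_) (sym r≡ry+rz) (ℕ.m<m+n ry (race-positive Z raceZ Z≢𝟘))
      rz<r : rz < r
      rz<r = subst (rz <_) (sym r≡ry+rz) (ℕ.m<n+m rz (race-positive Y raceY Y≢𝟘))

-- Splitting off a terminable atom

goodOption-≋-rightOpt : ∀ G S H → LeftDeadEnd G → LeftDeadEnd S → IsGoodOption G H → G ≋ S →
  ∃[ s ] (s ∈ rightOpts S × H ≋ s)
goodOption-≋-rightOpt G S H dG dS (H∈ , good) (G⊒S , S⊒G) = matchBack (⊒-match G⊒S H∈ᴿ)
  where
  H∈ᴿ : H ∈ rightOpts G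
  H∈ᴿ = deadEnd-option⇒rightOpt G dG H∈
  dH : LeftDeadEnd H
  dH = deadEnd-rightOpt G dG H∈ᴿ
  matchBack : ∃[ s ] (s ∈ rightOpts S × H ⊒ s) → ∃[ s ] (s ∈ rightOpts S × H ≋ s)
  matchBack (s , s∈ , H⊒s) with ⊒-match S⊒G s∈
  ... | g , g∈ , s⊒g with g ⊒? H
  ...   | yes g⊒H = s , s∈ , H⊒s , ⊒-trans s⊒g g⊒H
  ...   | no g⋣H  = contradiction H>g (good g (rightOpt⇒option G g∈))
    where
    dg : LeftDeadEnd g
    dg = deadEnd-rightOpt G dG g∈
    H>g : H > g
    H>g = ⊒⇒≥ dH dg (⊒-trans H⊒s s⊒g) , g⋣H ∘ ≥⇒⊒ dg dH ∘ proj₂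

data SummandRightMove : List Game → Game → Set where
  inSummand : ∀ before {a a′} after → a′ ∈ rightOpts a →
    SummandRightMove (before ++ a ∷ after) (sumList (before ++ a′ ∷ after))

sumList-rightOpts⁻ : ∀ As {s} → s ∈ rightOpts (sumList As) → SummandRightMove As s
sumList-rightOpts⁻ (A ∷ As) p with rightOpts-+⁻ A (sumList As) p
... | moveˡ q = inSummand [] As q
... | moveʳ q with sumList-rightOpts⁻ As q
...   | inSummand before after r = inSummand (A ∷ before) after r

extraSummand≡𝟘 : ∀ H a Rs → LeftDeadEnd H → LeftDeadEnd a → AllAtoms Rs → H ≋ a + sumList Rs →
  (∀ Bs → IsFactorisation H Bs → length Bs ≤ length Rs) → a ≡ 𝟘
extraSummand≡𝟘 H a Rs dH da atomsRs H≋a+ΣRs maximal with ≡𝟘? a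
... | yes a≡𝟘 = a≡𝟘
... | no a≢𝟘  = ⊥-elim (¬¬-factorisable a da λ (Cs , fCs) → tooLong Cs fCs)
  where
  dΣ : LeftDeadEnd (sumList Rs)
  dΣ = sumList-deadEnd atomsRs
  tooLong : ∀ Cs → IsFactorisation a Cs → ⊥
  tooLong Cs fCs = ℕ.<⇒≱ (ℕ.m<n+m (length Rs) (factorisation-nonempty a da a≢𝟘 fCs))
    (subst (_≤ length Rs) (length-++ Cs) (maximal (Cs ++ Rs)
      (factorisation-resp-≋ dH (deadEnd-+ a _ da dΣ) H≋a+ΣRs
        (factorisation-+ a (sumList Rs) da dΣ fCs (sumList-factorisation atomsRs)))))

data TerminableSplit (H : Game) : List Game → Set where
  splitOff : ∀ before {a} after → 𝟘 ∈ options a → H ≋ sumList (before ++ after) →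
    TerminableSplit H (before ++ a ∷ after)

splitAtom : TerminableSplit H As → Game
splitAtom (splitOff _ {a} _ _ _) = a

splitRest : TerminableSplit H As → List Game
splitRest (splitOff before after _ _) = before ++ after

terminableSplit : ∀ G H n → LeftDeadEnd G → IsGoodOption G H →
  (∀ Bs → IsFactorisation H Bs → length Bs ≤ n) →
  IsFactorisation G As → length As ≡ suc n → TerminableSplit H As
terminableSplit {As} G H n dG good maximal (atoms , G≈ΣAs) |As|≡1+n
  with goodOption-≋-rightOpt G (sumList As) H dG (sumList-deadEnd atoms) good
         (≈⇒≋ dG (sumList-deadEnd atoms) G≈ΣAs)
... | s , s∈ , H≋s with sumList-rightOpts⁻ As s∈
...   | inSummand before {a} {a′} after a′∈ =
  splitOff before after (rightOpt⇒option a (subst (_∈ rightOpts a) a′≡𝟘 a′∈))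
    (≋-trans H≋a′+rest (≡⇒≋ (trans (cong (_+ sumList (before ++ after)) a′≡𝟘) (+-identityˡ-≡ _))))
  where
  atomsRest : AllAtoms (before ++ after)
  atomsRest = proj₂ (AllAtoms-middle before atoms)
  H≋a′+rest : H ≋ a′ + sumList (before ++ after)
  H≋a′+rest = ≋-trans H≋s (sumList-middle before a′ after)
  |rest|≡n : length (before ++ after) ≡ n
  |rest|≡n = ℕ.suc-injective (trans (sym (length-++-sucʳ before a after)) |As|≡1+n)
  a′≡𝟘 : a′ ≡ 𝟘
  a′≡𝟘 = extraSummand≡𝟘 H a′ (before ++ after) (deadEnd-option G dG (proj₁ good))
    (deadEnd-rightOpt a (proj₁ (proj₁ (AllAtoms-middle before atoms))) a′∈) atomsRest H≋a′+rest
    (λ Bs fBs → subst (length Bs ≤_) (sym |rest|≡n) (maximal Bs fBs))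

splitAtom-isAtom : AllAtoms As → (t : TerminableSplit H As) → IsAtom (splitAtom t)
splitAtom-isAtom atoms (splitOff before _ _ _) = proj₁ (AllAtoms-middle before atoms)

splitAtom-terminable : (t : TerminableSplit H As) → 𝟘 ∈ options (splitAtom t)
splitAtom-terminable (splitOff _ _ 𝟘∈ _) = 𝟘∈

splitRest-factorisation : LeftDeadEnd H → AllAtoms As → (t : TerminableSplit H As) →
  IsFactorisation H (splitRest t)
splitRest-factorisation dH atoms (splitOff before _ _ H≋ΣRest) =
  let atomsRest = proj₂ (AllAtoms-middle before atoms) in
  atomsRest , ≋⇒≈ dH (sumList-deadEnd atomsRest) H≋ΣRest

splitRest-length : (t : TerminableSplit H As) → length As ≡ suc (length (splitRest t))
splitRest-length (splitOff before {a} after _ _) = length-++-sucʳ before a after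

split-≋ : ∀ G H → LeftDeadEnd G → IsFactorisation G As → (t : TerminableSplit H As) →
  G ≋ H + splitAtom t
split-≋ G H dG (atoms , G≈ΣAs) (splitOff before {a} after _ H≋ΣRest) = begin
  G                              ≈⟨ ≈⇒≋ dG (sumList-deadEnd atoms) G≈ΣAs ⟩
  sumList (before ++ a ∷ after)  ≈⟨ sumList-middle before a after ⟩
  a + sumList (before ++ after)  ≈⟨ +-congˡ-≋ H≋ΣRest ⟨
  a + H                          ≈⟨ +-comm-≋ a H ⟩
  H + a                          ∎
  where open SetoidReasoning ≋-setoid

split-↭ : ∀ {K} (t : TerminableSplit H As) → splitAtom t ≈ K → As ≈Fac splitRest t ++ [ K ]
split-↭ {K = K} (splitOff before after _ _) a≈K =
  ↭-trans (shift a≈K before after) (++-comm [ K ] (before ++ after))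

terminable-race : ∀ {K} → 𝟘 ∈ options K → IsRace K 1
terminable-race {K} 𝟘∈ = (𝟘 , 𝟘∈ , refl) , minimal
  where
  minimal : ∀ k → TerminalRun K k → 1 ≤ k
  minimal zero    K≡𝟘 = case subst (λ Z → 𝟘 ∈ options Z) K≡𝟘 𝟘∈ of λ ()
  minimal (suc k) _   = s≤s z≤n

racingOption-+ : ∀ G H K → LeftDeadEnd G → LeftDeadEnd H → LeftDeadEnd K →
  H ∈ options G → G ≋ H + K → IsRace K 1 → IsRacingOption G H
racingOption-+ G H K dG dH dK H∈ G≋H+K raceK =
  let r , raceH = race-exists H in
  H∈ , r , raceH ,
  race-resp-≋ (deadEnd-+ H K dH dK) dG (≋-sym G≋H+K)
    (subst (IsRace (H + K)) (ℕ.+-comm r 1) (race-+ H K raceH raceK))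

ExtendsLongestFactorisation : Game → Game → List Game → Set
ExtendsLongestFactorisation H K Bs =
  Σ[ Hs ∈ List Game ] (IsLongestFactorisation H Hs × Bs ≈Fac Hs ++ [ K ])

longestFactorisation-length : HasMaxFactorisationLength G n → IsLongestFactorisation G Bs →
  length Bs ≡ n
longestFactorisation-length {Bs = Bs} (As , (fAs , |As|≡n) , maximal) (fBs , longest) =
  ℕ.≤-antisym (maximal Bs fBs) (subst (_≤ length Bs) |As|≡n (longest As fAs))

longestFactorisation-of : (ℓG : HasMaxFactorisationLength G n) → IsLongestFactorisation G (proj₁ ℓG)
longestFactorisation-of (As , (fAs , |As|≡n) , maximal) =
  fAs , λ Bs fBs → subst (length Bs ≤_) (sym |As|≡n) (maximal Bs fBs)

longestFactorisation-split : ∀ G H K n → LeftDeadEnd G → IsGoodOption G H → IsAtom K → G ≈ H + K →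
  (∀ Bs → IsFactorisation H Bs → length Bs ≤ n) → HasMaxFactorisationLength G (suc n) →
  ∀ Bs → IsLongestFactorisation G Bs → ExtendsLongestFactorisation H K Bs
longestFactorisation-split G H K n dG good atomK G≈H+K maximalH ℓG Bs longestBs@(fBs , _) =
  splitRest t ,
  (splitRest-factorisation dH (proj₁ fBs) t ,
   λ Cs fCs → subst (length Cs ≤_) |rest|≡n (maximalH Cs fCs)) ,
  split-↭ t atom≈K
  where
  dH : LeftDeadEnd H
  dH = deadEnd-option G dG (proj₁ good)
  |Bs|≡1+n : length Bs ≡ suc n
  |Bs|≡1+n = longestFactorisation-length ℓG longestBs
  t : TerminableSplit H Bs
  t = terminableSplit G H n dG good maximalH fBs |Bs|≡1+n
  |rest|≡n : n ≡ length (splitRest t)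
  |rest|≡n = ℕ.suc-injective (trans (sym |Bs|≡1+n) (splitRest-length t))
  dA : LeftDeadEnd (splitAtom t)
  dA = proj₁ (splitAtom-isAtom (proj₁ fBs) t)
  atom≈K : splitAtom t ≈ K
  atom≈K = +-cancelˡ-≈ H (splitAtom t) K dH dA (proj₁ atomK)
    (≈-trans (≈-sym (≋⇒≈ dG (deadEnd-+ H _ dH dA) (split-≋ G H dG fBs t))) G≈H+K)

uniqueLongestFactorisation-++ : ∀ {K} → IsLongestFactorisation G As →
  (∀ Bs → IsLongestFactorisation G Bs → ExtendsLongestFactorisation H K Bs) →
  HasUniqueLongestFactorisation H → HasUniqueLongestFactorisation G
uniqueLongestFactorisation-++ {G = G} {As = As} {K = K} longestAs split (_ , _ , uniqueH) =
  As , longestAs , unique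
  where
  unique : ∀ Bs Cs → IsLongestFactorisation G Bs → IsLongestFactorisation G Cs → Bs ≈Fac Cs
  unique Bs Cs longestBs longestCs =
    let Hs , longestHs , Bs↭ = split Bs longestBs
        Hs′ , longestHs′ , Cs↭ = split Cs longestCs
    in ↭-trans Bs↭ (↭-trans (++⁺ʳ [ K ] (uniqueH Hs Hs′ longestHs longestHs′)) (↭-sym Cs↭))

mainTheorem16 :
  (G H : Game) → LeftDeadEnd G → IsGoodOption G H →
  (n : ℕ) → HasMaxFactorisationLength H n →
  HasMaxFactorisationLength G (suc n) →
  -- (1) H is a racing option of G
  IsRacingOption G H ×
  -- (2) a unique (up to =) atom K with G = H + K, and K is terminable
  (Σ[ K ∈ Game ]
    (IsAtom K × G ≈ H + K × Terminable K ×
     ((K' : Game) → IsAtom K' → G ≈ H + K' → K' ≈ K) ×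
     -- (3) every longest factorisation of G is H₁+…+H_k+K with
     --     H₁+…+H_k a longest factorisation of H
     ((As : List Game) → IsLongestFactorisation G As →
        Σ[ Hs ∈ List Game ]
          (IsLongestFactorisation H Hs × As ≈Fac (Hs ++ (K ∷ [])))))) ×
  -- (4) uniqueness of longest factorisation transfers from H to G
  (HasUniqueLongestFactorisation H → HasUniqueLongestFactorisation G)
mainTheorem16 G H dG good n (_ , _ , maximalH) ℓG@(As , (fAs , |As|≡1+n) , _) =
  racingOption-+ G H K dG dH dK (proj₁ good) G≋H+K (terminable-race 𝟘∈K) ,
  (K , atomK , G≈H+K , (dK , 𝟘∈K) , unique , longestSplit) ,
  uniqueLongestFactorisation-++ (longestFactorisation-of ℓG) longestSplit
  where
  dH : LeftDeadEnd H
  dH = deadEnd-option G dG (proj₁ good)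
  split : TerminableSplit H As
  split = terminableSplit G H n dG good maximalH fAs |As|≡1+n
  K : Game
  K = splitAtom split
  atomK : IsAtom K
  atomK = splitAtom-isAtom (proj₁ fAs) split
  dK : LeftDeadEnd K
  dK = proj₁ atomK
  𝟘∈K : 𝟘 ∈ options K
  𝟘∈K = splitAtom-terminable split
  G≋H+K : G ≋ H + K
  G≋H+K = split-≋ G H dG fAs split
  G≈H+K : G ≈ H + K
  G≈H+K = ≋⇒≈ dG (deadEnd-+ H K dH dK) G≋H+K
  unique : ∀ K′ → IsAtom K′ → G ≈ H + K′ → K′ ≈ K
  unique K′ atomK′ G≈H+K′ =
    +-cancelˡ-≈ H K′ K dH (proj₁ atomK′) dK (≈-trans (≈-sym G≈H+K′) G≈H+K)
  longestSplit : ∀ Bs → IsLongestFactorisation G Bs → ExtendsLongestFactorisation H K Bs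
  longestSplit = longestFactorisation-split G H K n dG good atomK G≈H+K maximalH ℓG
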